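{- Let $R$ be a $k$-ary symmetric Boolean relation with set of satisfying weights $S\subseteq\{0,1,\ldots,k\}$, and let $U=\{0,1,\ldots,k\}\setminus S$. If there exist $a,b,c\in S$ and $d\in U$ with $a-b+c=d$, then $R$ cone-defines the $2$-OR relation.
   Context: A $k$-ary Boolean relation $R\subseteq\{0,1\}^k$ is symmetric with set of satisfying weights $S$ if $x\in R$ iff the number of ones in $x$ lies in $S$. The $2$-OR relation is $\{(0,1),(1,0),(1,1)\}$. A relation $T$ of arity $m$ is cone-definable from (cone-defined by) a relation $U'$ of arity $n$ if there is a tuple $(y_1,\ldots,y_n)$ with each $y_j\in\{0,1\}\cup\{x_1,\ldots,x_m\}\cup\{\neg x_1,\ldots,\neg x_m\}$, every $x_i$ occurs (as $x_i$ or $\neg x_i$) among the $y_j$, and for each $f\colon\{x_1,\ldots,x_m\}\to\{0,1\}$: $(f(x_1),\ldots,f(x_m))\in T$ iff $(\hat f(y_1),\ldots,\hat f(y_n))\in U'$, where $\hat f(0)=0$, $\hat f(1)=1$, $\hat f(x_i)=f(x_i)$, $\hat f(\neg x_i)=\neg f(x_i)$. -}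

module Defs where

open import Data.Bool using (Bool; true; false; not)
open import Data.Nat using (ℕ; zero; suc; _+_)
open import Data.Fin using (Fin)
open import Data.Vec using (Vec; []; _∷_; map; lookup)
open import Data.Vec.Membership.Propositional using (_∈_)
open import Data.Product using (Σ; _×_; ∃)
open import Data.Sum using (_⊎_)
open import Function.Bundles using (_⇔_)
open import Relation.Binary.PropositionalEquality using (_≡_)

BRel : ℕ → Set₁
BRel k = Vec Bool k → Set

weight : ∀ {k} → Vec Bool k → ℕ
weight [] = 0
weight (true ∷ xs) = suc (weight xs)
weight (false ∷ xs) = weight xs

SymmetricWithWeights : ∀ {k} → BRel k → (ℕ → Set) → Set
SymmetricWithWeights {k} R S = ∀ (x : Vec Bool k) → R x ⇔ S (weight x)

OR2 : BRel 2
OR2 (x ∷ y ∷ []) = (x ≡ true) ⊎ (y ≡ true)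


data Lit (m : ℕ) : Set where
  const : Bool → Lit m
  pos   : Fin m → Lit m
  neg   : Fin m → Lit m

evalLit : ∀ {m} → Vec Bool m → Lit m → Bool
evalLit f (const b) = b
evalLit f (pos i) = lookup f i
evalLit f (neg i) = not (lookup f i)

Occurs : ∀ {m n} → Fin m → Vec (Lit m) n → Set
Occurs i ys = (pos i ∈ ys) ⊎ (neg i ∈ ys)

ConeDefinable : ∀ {m n} → BRel m → BRel n → Set
ConeDefinable {m} {n} T U′ =
  Σ (Vec (Lit m) n) λ ys →
    (∀ (i : Fin m) → Occurs i ys) ×
    (∀ (f : Vec Bool m) → T f ⇔ U′ (map (evalLit f) ys))

module Submission where

-- Read the weights a, b, c, d as the corners of an axis-parallel
-- rectangle: a + c = b + d with b ∉ {a, c} means that, for some base t and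
-- sides P, Q ≥ 1, the four numbers are t, t + P, t + Q, t + P + Q, with b and d
-- at opposite corners.  The cone gadget for such a rectangle is the tuple
--   (t ones, P copies of ±x, Q copies of ±y, F zeros),
-- whose weight under (x, y) is t + P·[±x] + Q·[±y].  Choosing the signs so
-- that the non-satisfying corner d is hit exactly by (x, y) = (0, 0), the
-- satisfying corners a, b, c are hit by the other three assignments, so the
-- gadget cone-defines 2-OR.

open import Defs
open import Data.Nat using (ℕ; zero; suc; _+_; _≤_)
open import Data.Nat.Properties
  using (suc-injective; +-suc; +-comm; +-identityʳ; +-cancelˡ-≡; m≤n⇒∃[o]m+o≡n)
open import Data.Bool using (Bool; true; false; not)
open import Data.Fin using (Fin)
open import Data.Fin.Patterns using (0F; 1F)
open import Data.Vec using (Vec; []; _∷_; map; replicate; lookup; _++_)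
open import Data.Vec.Properties using (map-++; map-replicate)
open import Data.Vec.Relation.Unary.Any using (here)
open import Data.Vec.Membership.Propositional using (_∈_)
open import Data.Vec.Membership.Propositional.Properties using (∈-++⁺ˡ; ∈-++⁺ʳ)
open import Data.Product using (Σ; _,_; proj₁; proj₂)
open import Data.Sum using (inj₁; inj₂)
open import Data.Empty using (⊥-elim)
open import Function.Bundles using (_⇔_; mk⇔)
open import Function.Construct.Composition using (_⇔-∘_)
open import Function.Construct.Symmetry using (⇔-sym)
open import Relation.Nullary using (¬_)
open import Relation.Binary.PropositionalEquality
  using (_≡_; _≢_; refl; sym; trans; cong; cong₂; subst; module ≡-Reasoning)

blockWeight : Bool → ℕ → ℕ
blockWeight true  n = n
blockWeight false n = 0

weight-++ : ∀ {m n} (xs : Vec Bool m) (ys : Vec Bool n)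
          → weight (xs ++ ys) ≡ weight xs + weight ys
weight-++ []           ys = refl
weight-++ (true ∷ xs)  ys = cong suc (weight-++ xs ys)
weight-++ (false ∷ xs) ys = weight-++ xs ys

weight-replicate : ∀ n u → weight (replicate n u) ≡ blockWeight u n
weight-replicate zero    true  = refl
weight-replicate zero    false = refl
weight-replicate (suc n) true  = cong suc (weight-replicate n true)
weight-replicate (suc n) false = weight-replicate n false

weight-map-++ : ∀ {A : Set} {m n} (g : A → Bool) (xs : Vec A m) (ys : Vec A n)
              → weight (map g (xs ++ ys)) ≡ weight (map g xs) + weight (map g ys)
weight-map-++ g xs ys = trans (cong weight (map-++ g xs ys)) (weight-++ (map g xs) (map g ys))

weight-map-replicate : ∀ {A : Set} (g : A → Bool) n (l : A)
                     → weight (map g (replicate n l)) ≡ blockWeight (g l) n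
weight-map-replicate g n l = trans (cong weight (map-replicate g l n)) (weight-replicate n (g l))

symmetric-by-weight : ∀ {k} {R : BRel k} {S : ℕ → Set} → SymmetricWithWeights R S
                    → ∀ v {w} → weight v ≡ w → R v ⇔ S w
symmetric-by-weight {R = R} {S} symR v eq = subst (λ w → R v ⇔ S w) eq (symR v)

signed : Bool → Bool → Bool
signed true  x = x
signed false x = not x

literal : ∀ {m} → Bool → Fin m → Lit m
literal true  i = pos i
literal false i = neg i

evalLit-literal : ∀ {m} (f : Vec Bool m) s i → evalLit f (literal s i) ≡ signed s (lookup f i)
evalLit-literal f true  i = refl
evalLit-literal f false i = refl

literal-occurs : ∀ {m n} s (i : Fin m) (ys : Vec (Lit m) n) → literal s i ∈ ys → Occurs i ys
literal-occurs true  i ys i∈ys = inj₁ i∈ys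
literal-occurs false i ys i∈ys = inj₂ i∈ys

-- A rectangle of weights: base t, sides suc xSide and suc ySide, and the
-- signs with which x and y enter the gadget.
record Frame : Set where
  constructor frame
  field
    base xSide ySide : ℕ
    xSign ySign : Bool

corner : Frame → Bool → Bool → ℕ
corner fr x y =
  base + (blockWeight (signed xSign x) (suc xSide) + blockWeight (signed ySign y) (suc ySide))
  where open Frame fr

span : Frame → ℕ
span fr = base + (suc xSide + suc ySide)
  where open Frame fr

span-is-corner : ∀ fr → corner fr (Frame.xSign fr) (Frame.ySign fr) ≡ span fr
span-is-corner (frame t p q true  true)  = refl
span-is-corner (frame t p q true  false) = refl
span-is-corner (frame t p q false true)  = refl
span-is-corner (frame t p q false false) = refl

baseBlock : (fr : Frame) → Vec (Lit 2) (Frame.base fr)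
baseBlock fr = replicate (Frame.base fr) (const true)

xBlock : (fr : Frame) → Vec (Lit 2) (suc (Frame.xSide fr))
xBlock fr = replicate (suc (Frame.xSide fr)) (literal (Frame.xSign fr) 0F)

yBlock : (fr : Frame) → Vec (Lit 2) (suc (Frame.ySide fr))
yBlock fr = replicate (suc (Frame.ySide fr)) (literal (Frame.ySign fr) 1F)

gadget : (fr : Frame) (F : ℕ) → Vec (Lit 2) (span fr + F)
gadget fr F = (baseBlock fr ++ (xBlock fr ++ yBlock fr)) ++ replicate F (const false)

gadget-weight : ∀ fr F x y → weight (map (evalLit (x ∷ y ∷ [])) (gadget fr F)) ≡ corner fr x y
gadget-weight fr F x y = begin
  weight (map g ((baseBlock fr ++ literals) ++ replicate F (const false)))
    ≡⟨ weight-map-++ g (baseBlock fr ++ literals) (replicate F (const false)) ⟩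
  weight (map g (baseBlock fr ++ literals)) + weight (map g (replicate F (const false)))
    ≡⟨ cong (weight (map g (baseBlock fr ++ literals)) +_) (weight-map-replicate g F (const false)) ⟩
  weight (map g (baseBlock fr ++ literals)) + 0
    ≡⟨ +-identityʳ _ ⟩
  weight (map g (baseBlock fr ++ literals))
    ≡⟨ weight-map-++ g (baseBlock fr) literals ⟩
  weight (map g (baseBlock fr)) + weight (map g literals)
    ≡⟨ cong₂ _+_ (weight-map-replicate g base (const true)) (weight-map-++ g (xBlock fr) (yBlock fr)) ⟩
  base + (weight (map g (xBlock fr)) + weight (map g (yBlock fr)))
    ≡⟨ cong (base +_) (cong₂ _+_ (block-weight xSign 0F xSide) (block-weight ySign 1F ySide)) ⟩
  corner fr x y ∎
  where
    open ≡-Reasoning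
    open Frame fr
    g : Lit 2 → Bool
    g = evalLit (x ∷ y ∷ [])
    literals : Vec (Lit 2) (suc xSide + suc ySide)
    literals = xBlock fr ++ yBlock fr
    block-weight : ∀ s i n → weight (map g (replicate (suc n) (literal s i)))
                           ≡ blockWeight (signed s (lookup (x ∷ y ∷ []) i)) (suc n)
    block-weight s i n = trans (weight-map-replicate g (suc n) (literal s i))
                               (cong (λ u → blockWeight u (suc n)) (evalLit-literal (x ∷ y ∷ []) s i))

-- Both variables occur in the gadget, since both literal blocks are non-empty.
gadget-occurs : ∀ fr F (i : Fin 2) → Occurs i (gadget fr F)
gadget-occurs fr F 0F = literal-occurs (Frame.xSign fr) 0F (gadget fr F)
  (∈-++⁺ˡ (∈-++⁺ʳ (baseBlock fr) (∈-++⁺ˡ {ys = yBlock fr} (here refl))))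
gadget-occurs fr F 1F = literal-occurs (Frame.ySign fr) 1F (gadget fr F)
  (∈-++⁺ˡ (∈-++⁺ʳ (baseBlock fr) (∈-++⁺ʳ (xBlock fr) (here refl))))

or2-by-cases : (P : Bool → Bool → Set)
             → ¬ P false false → P true false → P false true → P true true
             → ∀ x y → OR2 (x ∷ y ∷ []) ⇔ P x y
or2-by-cases P ¬P00 P10 P01 P11 false false = mk⇔ (λ { (inj₁ ()) ; (inj₂ ()) }) (λ p → ⊥-elim (¬P00 p))
or2-by-cases P ¬P00 P10 P01 P11 true  false = mk⇔ (λ _ → P10) (λ _ → inj₁ refl)
or2-by-cases P ¬P00 P10 P01 P11 false true  = mk⇔ (λ _ → P01) (λ _ → inj₂ refl)
or2-by-cases P ¬P00 P10 P01 P11 true  true  = mk⇔ (λ _ → P11) (λ _ → inj₁ refl)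

cone-from-frame : ∀ {k} {R : BRel k} {S : ℕ → Set} → SymmetricWithWeights R S
                → (fr : Frame) (F : ℕ) → span fr + F ≡ k
                → ¬ S (corner fr false false) → S (corner fr true false)
                → S (corner fr false true) → S (corner fr true true)
                → ConeDefinable OR2 R
cone-from-frame {S = S} symR fr F refl ¬S00 S10 S01 S11 = gadget fr F , gadget-occurs fr F , defines
  where
    defines : ∀ f → OR2 f ⇔ _
    defines (x ∷ y ∷ []) =
      ⇔-sym (symmetric-by-weight {S = S} symR _ (gadget-weight fr F x y))
      ⇔-∘ or2-by-cases (λ x y → S (corner fr x y)) ¬S00 S10 S01 S11 x y

record Rectangle (a b c d : ℕ) : Set where
  field
    shape : Frame
    corner-00 : corner shape false false ≡ d
    corner-01 : corner shape false true  ≡ a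
    corner-10 : corner shape true  false ≡ c
    corner-11 : corner shape true  true  ≡ b

raise : ∀ {a b c d} → Rectangle a b c d → Rectangle (suc a) (suc b) (suc c) (suc d)
raise r = record
  { shape = frame (suc base) xSide ySide xSign ySign
  ; corner-00 = cong suc corner-00 ; corner-01 = cong suc corner-01
  ; corner-10 = cong suc corner-10 ; corner-11 = cong suc corner-11 }
  where open Rectangle r; open Frame shape

-- If a, b, c, d ≤ k then every corner, in particular the span, is ≤ k.
span-bounded : ∀ {a b c d k} (r : Rectangle a b c d) → a ≤ k → b ≤ k → c ≤ k → d ≤ k
             → span (Rectangle.shape r) ≤ k
span-bounded {k = k} r a≤k b≤k c≤k d≤k =
  subst (_≤ k) (span-is-corner shape) (corner-bounded (Frame.xSign shape) (Frame.ySign shape))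
  where
    open Rectangle r
    corner-bounded : ∀ x y → corner shape x y ≤ k
    corner-bounded false false = subst (_≤ k) (sym corner-00) d≤k
    corner-bounded false true  = subst (_≤ k) (sym corner-01) a≤k
    corner-bounded true  false = subst (_≤ k) (sym corner-10) c≤k
    corner-bounded true  true  = subst (_≤ k) (sym corner-11) b≤k

-- Four numbers with a + c = b + d and b ∉ {a, c} form a rectangle.  By
-- lowering all four while they are positive it suffices to treat the case
-- where one of them, the base corner, is 0.
rectangle : ∀ a b c d → a + c ≡ b + d → b ≢ a → b ≢ c → Rectangle a b c d
rectangle (suc a) (suc b) (suc c) (suc d) eq b≢a b≢c =
  raise (rectangle a b c d lowered (λ e → b≢a (cong suc e)) (λ e → b≢c (cong suc e)))
  where
    lowered : a + c ≡ b + d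
    lowered = suc-injective (suc-injective
      (trans (cong suc (sym (+-suc a c))) (trans eq (cong suc (+-suc b d)))))
rectangle zero zero _ _ _ b≢a _ = ⊥-elim (b≢a refl)
rectangle _ zero zero _ _ _ b≢c = ⊥-elim (b≢c refl)
rectangle (suc p) zero (suc q) d eq _ _ = record
  { shape = frame 0 p q false false
  ; corner-00 = eq ; corner-01 = +-identityʳ (suc p) ; corner-10 = refl ; corner-11 = refl }
rectangle zero (suc p) c zero eq _ b≢c = ⊥-elim (b≢c (sym (trans eq (+-identityʳ (suc p)))))
rectangle zero (suc p) c (suc q) eq _ _ = record
  { shape = frame 0 p q true false
  ; corner-00 = refl ; corner-01 = refl ; corner-10 = sym eq ; corner-11 = +-identityʳ (suc p) }
rectangle (suc a) (suc p) zero zero eq b≢a _ =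
  ⊥-elim (b≢a (sym (trans (sym (+-identityʳ (suc a))) (trans eq (+-identityʳ (suc p))))))
rectangle (suc a) (suc p) zero (suc q) eq _ _ = record
  { shape = frame 0 q p false true
  ; corner-00 = +-identityʳ (suc q)
  ; corner-01 = trans (+-comm (suc q) (suc p)) (sym (trans (sym (+-identityʳ (suc a))) eq))
  ; corner-10 = refl ; corner-11 = refl }
rectangle (suc a) (suc b) (suc c) zero eq _ _ = record
  { shape = frame 0 c a true true
  ; corner-00 = refl ; corner-01 = refl ; corner-10 = +-identityʳ (suc c)
  ; corner-11 = trans (+-comm (suc c) (suc a)) (trans eq (+-identityʳ (suc b))) }

lemma5p3 : (k : ℕ) (R : BRel k) (S : ℕ → Set)
           → (∀ w → S w → w ≤ k)
           → SymmetricWithWeights R S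
           → (a b c d : ℕ)
           → S a → S b → S c → d ≤ k → ¬ S d
           → a + c ≡ b + d
           → ConeDefinable OR2 R
lemma5p3 k R S bounded symR a b c d Sa Sb Sc d≤k ¬Sd a+c≡b+d =
  cone-from-frame {S = S} symR shape F span+F≡k
    (λ S00 → ¬Sd (subst S corner-00 S00))
    (subst S (sym corner-10) Sc) (subst S (sym corner-01) Sa) (subst S (sym corner-11) Sb)
  where
    -- b = a would force d = c ∈ S, and b = c would force d = a ∈ S.
    b≢a : b ≢ a
    b≢a b≡a = ¬Sd (subst S (+-cancelˡ-≡ a c d (trans a+c≡b+d (cong (_+ d) b≡a))) Sc)
    b≢c : b ≢ c
    b≢c b≡c = ¬Sd (subst S (+-cancelˡ-≡ c a d (trans (+-comm c a) (trans a+c≡b+d (cong (_+ d) b≡c)))) Sa)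

    r : Rectangle a b c d
    r = rectangle a b c d a+c≡b+d b≢a b≢c
    open Rectangle r

    padding : Σ ℕ λ F → span shape + F ≡ k
    padding = m≤n⇒∃[o]m+o≡n (span-bounded r (bounded a Sa) (bounded b Sb) (bounded c Sc) d≤k)
    F : ℕ
    F = proj₁ padding
    span+F≡k : span shape + F ≡ k
    span+F≡k = proj₂ padding
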